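{- Let $p$ be a prime and let $V$ be an $\mathbb{F}_p$-vector space of finite dimension $d\geq 3$ with a skew-symmetric bilinear form $(\cdot,\cdot)\colon V\times V\to\mathbb{F}_p$. Then there exists a basis $v_1,\ldots,v_d$ of $V$ such that $(v_1,v_2)=(v_2,v_3)=\cdots=(v_{d-1},v_d)=0$.
   Context: A bilinear form is skew-symmetric if $(x,y)=-(y,x)$ for all $x,y$. No non-degeneracy is assumed. -}

module Defs where

open import Data.Nat using (ℕ; zero; suc)
open import Data.Fin using (Fin; zero; suc; toℕ)
open import Data.Integer using (ℤ; +_; _+_; _*_; _-_; -_)
open import Data.Integer.Divisibility using (_∣_)
open import Data.Product using (Σ; _×_)

-- The prime field 𝔽_p is modelled by integers modulo p:
-- a ≡ b (mod p) iff p divides a - b.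
_≡[_]_ : ℤ → ℕ → ℤ → Set
a ≡[ p ] b = (+ p) ∣ (a - b)

-- V = 𝔽_p^d, vectors given by integer coordinates (taken mod p).
Vect : ℕ → Set
Vect d = Fin d → ℤ

_≈[_]_ : ∀ {d} → Vect d → ℕ → Vect d → Set
x ≈[ p ] y = ∀ k → x k ≡[ p ] y k

_⊕_ : ∀ {d} → Vect d → Vect d → Vect d
(x ⊕ y) k = x k + y k

_⊙_ : ∀ {d} → ℤ → Vect d → Vect d
(c ⊙ x) k = c * x k

zeroV : ∀ {d} → Vect d
zeroV k = + 0

∑ : ∀ {n} → (Fin n → ℤ) → ℤ
∑ {zero}  f = + 0
∑ {suc n} f = f zero + ∑ {n} (λ i → f (suc i))

linComb : ∀ {n d} → (Fin n → ℤ) → (Fin n → Vect d) → Vect d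
linComb c v k = ∑ (λ i → c i * v i k)

record IsBilinearForm (p : ℕ) {d : ℕ} (B : Vect d → Vect d → ℤ) : Set where
  field
    well-defined : ∀ x x′ y y′ → x ≈[ p ] x′ → y ≈[ p ] y′ → B x y ≡[ p ] B x′ y′
    add-left     : ∀ x y z → B (x ⊕ y) z ≡[ p ] (B x z + B y z)
    scale-left   : ∀ c x z → B (c ⊙ x) z ≡[ p ] (c * B x z)
    add-right    : ∀ x y z → B x (y ⊕ z) ≡[ p ] (B x y + B x z)
    scale-right  : ∀ c x y → B x (c ⊙ y) ≡[ p ] (c * B x y)

IsSkewSymmetric : (p : ℕ) {d : ℕ} → (Vect d → Vect d → ℤ) → Set
IsSkewSymmetric p B = ∀ x y → B x y ≡[ p ] (- B y x)

LinearlyIndependent : (p : ℕ) {n d : ℕ} → (Fin n → Vect d) → Set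
LinearlyIndependent p v = ∀ c → linComb c v ≈[ p ] zeroV → ∀ i → c i ≡[ p ] (+ 0)

Spans : (p : ℕ) {n d : ℕ} → (Fin n → Vect d) → Set
Spans p v = ∀ x → Σ _ λ c → x ≈[ p ] linComb c v

IsBasis : (p : ℕ) {n d : ℕ} → (Fin n → Vect d) → Set
IsBasis p v = LinearlyIndependent p v × Spans p v

module Submission where

-- Start from the standard basis and repair it, one consecutive
-- pair at a time, into a basis v₀,…,v_{d-1} with v₀ ⟂ v₁ ⟂ ⋯ ⟂ v_{d-1}.
-- Only two kinds of moves are used, and both turn bases into bases:
--   * transvections  w_a ↦ w_a + t·w_b  (a ≠ b), and
--   * permutations of the positions (a transposition and a rotation).
-- To make w_m ⟂ w_{m+1} while the vector w_{m+2} is available, either swap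
-- w_{m+1} with w_{m+2}, or add to w_{m+1} the multiple of w_{m+2} that makes it
-- orthogonal to w_m; solving for that multiple is where p prime is used.  The last
-- pair (w_{d-2}, w_{d-1}) has no spare vector after it; there we use w₀ and w_{d-3}
-- instead (so d ≥ 3 is needed) and possibly move w_{d-1} to the front.

open import Defs
open import Data.Nat as ℕ using (ℕ; zero; suc; _≤_; _<_; s≤s; z≤n; NonZero)
import Data.Nat.Properties as ℕₚ
open import Data.Nat.Primality using (Prime; prime⇒nonZero)
open import Data.Nat.Coprimality using (coprime-Bézout; prime⇒coprime)
import Data.Nat.Coprimality as Coprime
open import Data.Nat.GCD using (module Bézout)
open import Data.Fin using (Fin; zero; suc; toℕ; fromℕ; fromℕ<; inject₁)
open import Data.Fin.Properties using (_≟_; suc-injective; toℕ-fromℕ; toℕ-fromℕ<; toℕ-inject₁; toℕ-injective; toℕ<n)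
open import Data.Fin.Permutation using (Permutation; permutation; _⟨$⟩ʳ_; _⟨$⟩ˡ_; inverseˡ; inverseʳ; transpose)
open import Data.Vec.Functional using (updateAt)
open import Data.Vec.Functional.Properties using (updateAt-updates; updateAt-minimal)
open import Data.Integer using (ℤ; +_; _+_; _*_; _-_; -_)
open import Data.Integer.DivMod using (_%ℕ_; _/ℕ_; n%ℕd<d; a≡a%ℕn+[a/ℕn]*n)
import Data.Integer.Divisibility.Signed as Signed
import Data.Integer.Properties as ℤₚ
open import Data.Integer.Tactic.RingSolver using (solve-∀)
open import Algebra.Properties.CommutativeMonoid.Sum ℤₚ.+-0-commutativeMonoid using (sum; sum-cong-≗; ∑-permute; sum-replicate-zero)
open import Data.Product using (Σ; _×_; _,_; proj₁; proj₂)
open import Data.Empty using (⊥-elim)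
open import Function using (_∘_)
open import Relation.Nullary using (¬_; Dec; yes; no)
open import Relation.Nullary.Decidable using (map′; dec-true; dec-false)
open import Relation.Binary.Bundles using (Setoid)
open import Relation.Binary.PropositionalEquality using (_≡_; _≢_; refl; sym; trans; cong; cong₂; subst; subst₂; module ≡-Reasoning)

module Congruence (p : ℕ) where

  infix 4 _≋_ _≋?_

  -- a ≋ b: a and b are congruent modulo p.  Wrapping the relation of Defs in
  -- a record lets a and b be inferred from a proof.
  record _≋_ (a b : ℤ) : Set where
    constructor ≋-intro
    field ≋-elim : a ≡[ p ] b

  open _≋_ public

  -- divisibility by p, in the signed form for which the library has closure lemmas
  Multiple : ℤ → Set
  Multiple x = + p Signed.∣ x

  ≋-by : ∀ {a b x} → Multiple x → x ≡ a - b → a ≋ b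
  ≋-by m refl = ≋-intro (Signed.∣⇒∣ᵤ m)

  difference : ∀ {a b} → a ≋ b → Multiple (a - b)
  difference (≋-intro m) = Signed.∣ᵤ⇒∣ m

  ≡⇒≋ : ∀ {a b} → a ≡ b → a ≋ b
  ≡⇒≋ {a} refl = ≋-by (Signed.divides (+ 0) refl) (sym (ℤₚ.+-inverseʳ a))

  ≋-sym : ∀ {a b} → a ≋ b → b ≋ a
  ≋-sym {a} {b} h = ≋-by (Signed.∣m⇒∣-m (difference h)) (identity a b)
    where
    identity : ∀ a b → - (a - b) ≡ b - a
    identity = solve-∀

  ≋-trans : ∀ {a b c} → a ≋ b → b ≋ c → a ≋ c
  ≋-trans {a} {b} {c} h g = ≋-by (Signed.∣m∣n⇒∣m+n (difference h) (difference g)) (identity a b c)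
    where
    identity : ∀ a b c → (a - b) + (b - c) ≡ a - c
    identity = solve-∀

  ≋-setoid : Setoid _ _
  ≋-setoid = record
    { Carrier = ℤ ; _≈_ = _≋_
    ; isEquivalence = record { refl = ≡⇒≋ refl ; sym = ≋-sym ; trans = ≋-trans } }

  +-cong : ∀ {a b c e} → a ≋ b → c ≋ e → a + c ≋ b + e
  +-cong {a} {b} {c} {e} h g = ≋-by (Signed.∣m∣n⇒∣m+n (difference h) (difference g)) (identity a b c e)
    where
    identity : ∀ a b c e → (a - b) + (c - e) ≡ (a + c) - (b + e)
    identity = solve-∀

  +-congˡ : ∀ a {c e} → c ≋ e → a + c ≋ a + e
  +-congˡ a = +-cong (≡⇒≋ {a} refl)

  *-congˡ : ∀ t {a b} → a ≋ b → t * a ≋ t * b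
  *-congˡ t {a} {b} h = ≋-by (Signed.∣n⇒∣m*n t (difference h)) (identity t a b)
    where
    identity : ∀ t a b → t * (a - b) ≡ t * a - t * b
    identity = solve-∀

  *-congʳ : ∀ t {a b} → a ≋ b → a * t ≋ b * t
  *-congʳ t {a} {b} h = subst₂ _≋_ (ℤₚ.*-comm t a) (ℤₚ.*-comm t b) (*-congˡ t h)

  neg-cong : ∀ {a b} → a ≋ b → - a ≋ - b
  neg-cong {a} {b} h = ≋-by (Signed.∣m⇒∣-m (difference h)) (identity a b)
    where
    identity : ∀ a b → - (a - b) ≡ - a - - b
    identity = solve-∀

  cancel-+ʳ : ∀ {a b} → a + b ≋ + 0 → b ≋ + 0 → a ≋ + 0
  cancel-+ʳ {a} {b} h g = ≋-by (Signed.∣m∣n⇒∣m-n (difference h) (difference g)) (identity a b)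
    where
    identity : ∀ a b → (a + b - + 0) - (b - + 0) ≡ a - + 0
    identity = solve-∀

  _≋?_ : ∀ a b → Dec (a ≋ b)
  a ≋? b = map′ (λ m → ≋-by m refl) difference (+ p Signed.∣? (a - b))

module PrimeField (p : ℕ) (prime : Prime p) where
  open Congruence p
  open ≡-Reasoning

  private instance
    p≢0 : NonZero p
    p≢0 = prime⇒nonZero prime

  ≋-remainder : ∀ x → x ≋ + (x %ℕ p)
  ≋-remainder x = ≋-by (Signed.divides (x /ℕ p) refl) (begin
    (x /ℕ p) * + p                               ≡⟨ identity (+ (x %ℕ p)) ((x /ℕ p) * + p) ⟩
    (+ (x %ℕ p) + (x /ℕ p) * + p) - + (x %ℕ p)   ≡⟨ cong (_- + (x %ℕ p)) (a≡a%ℕn+[a/ℕn]*n x p) ⟨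
    x - + (x %ℕ p)                               ∎)
    where
    identity : ∀ r m → m ≡ (r + m) - r
    identity = solve-∀

  ℕ⇒ℤ : ∀ c a m b n → c ℕ.+ a ℕ.* m ≡ b ℕ.* n → + c + + a * + m ≡ + b * + n
  ℕ⇒ℤ c a m b n eq = begin
    + c + + a * + m     ≡⟨ cong (λ z → + c + z) (ℤₚ.pos-* a m) ⟨
    + c + + (a ℕ.* m)   ≡⟨ ℤₚ.pos-+ c (a ℕ.* m) ⟨
    + (c ℕ.+ a ℕ.* m)   ≡⟨ cong +_ eq ⟩
    + (b ℕ.* n)         ≡⟨ ℤₚ.pos-* b n ⟩
    + b * + n           ∎

  -- a non-zero remainder r < p is invertible, by Bézout's identity for the coprime pair r, p
  remainder-inverse : ∀ r .{{_ : NonZero r}} → r < p → Σ ℤ λ y → + r * y ≋ + 1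
  remainder-inverse r r<p with coprime-Bézout (Coprime.sym (prime⇒coprime prime r<p))
  ... | Bézout.+- a b eq = + a , ≋-by (Signed.divides (+ b) refl) (begin
    + b * + p                  ≡⟨ identity₁ (+ b * + p) ⟩
    (+ 1 + + b * + p) - + 1    ≡⟨ cong (_- + 1) (ℕ⇒ℤ 1 b p a r eq) ⟩
    + a * + r - + 1            ≡⟨ cong (_- + 1) (ℤₚ.*-comm (+ a) (+ r)) ⟩
    + r * + a - + 1            ∎)
    where
    identity₁ : ∀ m → m ≡ (+ 1 + m) - + 1
    identity₁ = solve-∀
  ... | Bézout.-+ a b eq = - + a , ≋-by (Signed.divides (- + b) refl) (begin
    - + b * + p                ≡⟨ identity₁ (+ b) (+ p) ⟩
    - (+ b * + p)              ≡⟨ cong -_ (ℕ⇒ℤ 1 a r b p eq) ⟨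
    - (+ 1 + + a * + r)        ≡⟨ identity₂ (+ a) (+ r) ⟩
    + r * - + a - + 1          ∎)
    where
    identity₁ : ∀ b p → - b * p ≡ - (b * p)
    identity₁ = solve-∀
    identity₂ : ∀ a r → - (+ 1 + a * r) ≡ r * - a - + 1
    identity₂ = solve-∀

  inverse : ∀ x → ¬ x ≋ + 0 → Σ ℤ λ y → x * y ≋ + 1
  inverse x x≉0 with x %ℕ p | ≋-remainder x | n%ℕd<d x p
  ... | zero  | x≋0 | _   = ⊥-elim (x≉0 x≋0)
  ... | suc r | x≋r | r<p with remainder-inverse (suc r) r<p
  ...   | y , ry≋1 = y , ≋-trans (*-congʳ y x≋r) ry≋1

  solve-linear : ∀ α β → ¬ β ≋ + 0 → Σ ℤ λ t → α + t * β ≋ + 0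
  solve-linear α β β≉0 with inverse β β≉0
  ... | y , βy≋1 = - (α * y) , ≋-by (Signed.∣m⇒∣-m (Signed.∣n⇒∣m*n α (difference βy≋1))) (identity α β y)
    where
    identity : ∀ α β y → - (α * (β * y - + 1)) ≡ α + - (α * y) * β - + 0
    identity = solve-∀

∑≗sum : ∀ {n} (f : Fin n → ℤ) → ∑ f ≡ sum f
∑≗sum {zero}  f = refl
∑≗sum {suc n} f = cong (_+_ (f zero)) (∑≗sum (f ∘ suc))

∑-cong : ∀ {n} {f g : Fin n → ℤ} → (∀ i → f i ≡ g i) → ∑ f ≡ ∑ g
∑-cong {f = f} {g} f≗g = trans (∑≗sum f) (trans (sum-cong-≗ f≗g) (sym (∑≗sum g)))

∑-change-one : ∀ {n} (f g : Fin n → ℤ) (a : Fin n) (e : ℤ) →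
               g a ≡ f a + e → (∀ i → i ≢ a → g i ≡ f i) → ∑ g ≡ ∑ f + e
∑-change-one {suc n} f g zero e here elsewhere = begin
  g zero + ∑ (g ∘ suc)       ≡⟨ cong₂ _+_ here (∑-cong λ i → elsewhere (suc i) λ ()) ⟩
  f zero + e + ∑ (f ∘ suc)   ≡⟨ identity (f zero) e (∑ (f ∘ suc)) ⟩
  f zero + ∑ (f ∘ suc) + e   ∎
  where
  open ≡-Reasoning
  identity : ∀ x e s → x + e + s ≡ x + s + e
  identity = solve-∀
∑-change-one {suc n} f g (suc a) e here elsewhere = begin
  g zero + ∑ (g ∘ suc)       ≡⟨ cong₂ _+_ (elsewhere zero λ ()) (∑-change-one (f ∘ suc) (g ∘ suc) a e here
                                   λ i i≢a → elsewhere (suc i) (i≢a ∘ suc-injective)) ⟩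
  f zero + (∑ (f ∘ suc) + e) ≡⟨ ℤₚ.+-assoc (f zero) _ e ⟨
  f zero + ∑ (f ∘ suc) + e   ∎
  where open ≡-Reasoning

transvect : ∀ {n d} → Fin n → Fin n → ℤ → (Fin n → Vect d) → (Fin n → Vect d)
transvect a b t w = updateAt w a (λ v → v ⊕ (t ⊙ w b))

transvect-here : ∀ {n d} (a b : Fin n) t (w : Fin n → Vect d) → transvect a b t w a ≡ w a ⊕ (t ⊙ w b)
transvect-here a b t w = updateAt-updates a w

transvect-elsewhere : ∀ {n d} {i a : Fin n} b t (w : Fin n → Vect d) → i ≢ a → transvect a b t w i ≡ w i
transvect-elsewhere {i = i} {a} b t w = updateAt-minimal i a w

linComb-transvect : ∀ {n d} c (a b : Fin n) t (w : Fin n → Vect d) k →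
                    linComb c (transvect a b t w) k ≡ linComb c w k + c a * (t * w b k)
linComb-transvect c a b t w k = ∑-change-one _ _ a _ here elsewhere
  where
  here : c a * transvect a b t w a k ≡ c a * w a k + c a * (t * w b k)
  here = trans (cong (λ v → c a * v k) (transvect-here a b t w)) (ℤₚ.*-distribˡ-+ (c a) _ _)
  elsewhere : ∀ i → i ≢ a → c i * transvect a b t w i k ≡ c i * w i k
  elsewhere i i≢a = cong (λ v → c i * v k) (transvect-elsewhere b t w i≢a)

linComb-shift : ∀ {n d} c (j : Fin n) s (w : Fin n → Vect d) k →
                linComb (updateAt c j (_+ s)) w k ≡ linComb c w k + s * w j k
linComb-shift c j s w k = ∑-change-one _ _ j _ here elsewhere
  where
  here : updateAt c j (_+ s) j * w j k ≡ c j * w j k + s * w j k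
  here = trans (cong (_* w j k) (updateAt-updates j c)) (ℤₚ.*-distribʳ-+ (w j k) (c j) s)
  elsewhere : ∀ i → i ≢ j → updateAt c j (_+ s) i * w i k ≡ c i * w i k
  elsewhere i i≢j = cong (_* w i k) (updateAt-minimal i j c i≢j)

∑-reindex : ∀ {n} (π : Permutation n n) (f : Fin n → ℤ) → ∑ f ≡ ∑ (f ∘ (π ⟨$⟩ʳ_))
∑-reindex π f = trans (∑≗sum f) (trans (∑-permute f π) (sym (∑≗sum (f ∘ (π ⟨$⟩ʳ_)))))

linComb-permute : ∀ {n d} (π : Permutation n n) c (w : Fin n → Vect d) k →
                  linComb c (w ∘ (π ⟨$⟩ʳ_)) k ≡ linComb (c ∘ (π ⟨$⟩ˡ_)) w k
linComb-permute π c w k = sym (trans (∑-reindex π (λ j → c (π ⟨$⟩ˡ j) * w j k))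
                                     (∑-cong λ i → cong (λ j → c j * w (π ⟨$⟩ʳ i) k) (inverseˡ π)))

unit : ∀ {d} → Fin d → Vect d
unit a = updateAt zeroV a (λ _ → + 1)

linComb-unit : ∀ {d} c (k : Fin d) → linComb c unit k ≡ c k
linComb-unit {d} c k = begin
  linComb c unit k         ≡⟨ ∑-change-one (λ _ → + 0) _ k (c k) here elsewhere ⟩
  ∑ {d} (λ _ → + 0) + c k  ≡⟨ cong (_+ c k) (trans (∑≗sum {d} (λ _ → + 0)) (sum-replicate-zero d)) ⟩
  + 0 + c k                ≡⟨ ℤₚ.+-identityˡ (c k) ⟩
  c k                      ∎
  where
  open ≡-Reasoning
  here : c k * unit k k ≡ + 0 + c k
  here = trans (cong (c k *_) (updateAt-updates k zeroV)) (trans (ℤₚ.*-identityʳ (c k)) (sym (ℤₚ.+-identityˡ (c k))))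
  elsewhere : ∀ i → i ≢ k → c i * unit i k ≡ + 0
  elsewhere i i≢k = trans (cong (c i *_) (updateAt-minimal k i zeroV (i≢k ∘ sym))) (ℤₚ.*-zeroʳ (c i))

module Bases (p : ℕ) where
  open Congruence p

  -- coordinates with respect to the standard basis are the entries themselves
  standard-basis : ∀ {d} → IsBasis p (unit {d})
  standard-basis = (λ c unit≈0 i → subst (λ z → z ≡[ p ] (+ 0)) (linComb-unit c i) (unit≈0 i))
                 , (λ x → x , λ k → ≋-elim (≡⇒≋ (sym (linComb-unit x k))))

  module _ {n d} (w : Fin n → Vect d) (a b : Fin n) (t : ℤ) (a≢b : a ≢ b) where

    -- if Σ cᵢ w′ᵢ = 0 for the transvected family w′, then the coefficients
    -- c with c_b shifted by c_a·t give a vanishing combination of w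
    transvect-independent : LinearlyIndependent p w → LinearlyIndependent p (transvect a b t w)
    transvect-independent independent c c≈0 i = ≋-elim (c≋0 i)
      where
      c′ : Fin n → ℤ
      c′ = updateAt c b (_+ c a * t)
      same : ∀ k → linComb c (transvect a b t w) k ≡ linComb c′ w k
      same k = trans (linComb-transvect c a b t w k)
                 (trans (cong (_+_ (linComb c w k)) (sym (ℤₚ.*-assoc (c a) t (w b k))))
                        (sym (linComb-shift c b (c a * t) w k)))
      c′≋0 : ∀ i → c′ i ≋ + 0
      c′≋0 i = ≋-intro (independent c′ (λ k → subst (λ z → z ≡[ p ] (+ 0)) (same k) (c≈0 k)) i)
      ca≋0 : c a ≋ + 0
      ca≋0 = subst (λ z → z ≋ + 0) (updateAt-minimal a b c a≢b) (c′≋0 a)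
      c≋0 : ∀ i → c i ≋ + 0
      c≋0 i with i ≟ b
      ... | yes refl = cancel-+ʳ (subst (λ z → z ≋ + 0) (updateAt-updates b c) (c′≋0 b))
                                 (subst (λ z → c a * t ≋ z) (ℤₚ.*-zeroˡ t) (*-congʳ t ca≋0))
      ... | no i≢b   = subst (λ z → z ≋ + 0) (updateAt-minimal i b c i≢b) (c′≋0 i)

    -- x = Σ cᵢ wᵢ is also Σ c′ᵢ w′ᵢ, where c′ shifts c_b by -c_a·t
    transvect-spans : Spans p w → Spans p (transvect a b t w)
    transvect-spans spans x with spans x
    ... | c , x≈c = c′ , λ k → subst (λ z → x k ≡[ p ] z) (sym (same k)) (x≈c k)
      where
      open ≡-Reasoning
      c′ : Fin n → ℤ
      c′ = updateAt c b (_+ - (c a * t))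
      identity : ∀ L u t v → L + - (u * t) * v + u * (t * v) ≡ L
      identity = solve-∀
      same : ∀ k → linComb c′ (transvect a b t w) k ≡ linComb c w k
      same k = begin
        linComb c′ (transvect a b t w) k                          ≡⟨ linComb-transvect c′ a b t w k ⟩
        linComb c′ w k + c′ a * (t * w b k)                       ≡⟨ cong₂ _+_ (linComb-shift c b _ w k)
                                                                        (cong (_* (t * w b k)) (updateAt-minimal a b c a≢b)) ⟩
        linComb c w k + - (c a * t) * w b k + c a * (t * w b k)   ≡⟨ identity (linComb c w k) (c a) t (w b k) ⟩
        linComb c w k                                             ∎

    transvect-basis : IsBasis p w → IsBasis p (transvect a b t w)
    transvect-basis (independent , spans) = transvect-independent independent , transvect-spans spans

  permute-basis : ∀ {n d} (π : Permutation n n) (w : Fin n → Vect d) → IsBasis p w → IsBasis p (w ∘ (π ⟨$⟩ʳ_))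
  permute-basis π w (independent , spans) = permuted-independent , permuted-spans
    where
    permuted-independent : LinearlyIndependent p (w ∘ (π ⟨$⟩ʳ_))
    permuted-independent c c≈0 i =
      subst (λ j → c j ≡[ p ] (+ 0)) (inverseˡ π)
        (independent (c ∘ (π ⟨$⟩ˡ_)) (λ k → subst (λ z → z ≡[ p ] (+ 0)) (linComb-permute π c w k) (c≈0 k)) (π ⟨$⟩ʳ i))
    permuted-spans : Spans p (w ∘ (π ⟨$⟩ʳ_))
    permuted-spans x with spans x
    ... | c , x≈c = c ∘ (π ⟨$⟩ʳ_) , λ k → subst (λ z → x k ≡[ p ] z) (sym (same k)) (x≈c k)
      where
      same : ∀ k → linComb (c ∘ (π ⟨$⟩ʳ_)) (w ∘ (π ⟨$⟩ʳ_)) k ≡ linComb c w k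
      same k = trans (linComb-permute π (c ∘ (π ⟨$⟩ʳ_)) w k) (∑-cong λ j → cong (λ i → c i * w j k) (inverseʳ π))

transpose-here : ∀ {n} (a b : Fin n) → transpose a b ⟨$⟩ʳ a ≡ b
transpose-here a b rewrite dec-true (a ≟ a) refl = refl

transpose-elsewhere : ∀ {n} (a b i : Fin n) → i ≢ a → i ≢ b → transpose a b ⟨$⟩ʳ i ≡ i
transpose-elsewhere a b i i≢a i≢b rewrite dec-false (i ≟ a) i≢a | dec-false (i ≟ b) i≢b = refl

rotation : ∀ {n} → Fin (suc n) → Fin (suc n)
rotation {n} zero = fromℕ n
rotation (suc i) = inject₁ i

rotation⁻¹ : ∀ {n} → Fin (suc n) → Fin (suc n)
rotation⁻¹ {zero}  zero    = zero
rotation⁻¹ {suc n} zero    = suc zero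
rotation⁻¹ {suc n} (suc i) = shift (rotation⁻¹ i)
  where
  shift : Fin (suc n) → Fin (suc (suc n))
  shift zero    = zero
  shift (suc j) = suc (suc j)

rotation⁻¹-last : ∀ n → rotation⁻¹ (fromℕ n) ≡ zero
rotation⁻¹-last zero    = refl
rotation⁻¹-last (suc n) rewrite rotation⁻¹-last n = refl

rotation⁻¹-inject₁ : ∀ {n} (i : Fin n) → rotation⁻¹ (inject₁ i) ≡ suc i
rotation⁻¹-inject₁ {suc n} zero    = refl
rotation⁻¹-inject₁ {suc n} (suc i) rewrite rotation⁻¹-inject₁ i = refl

rotation⁻¹-rotation : ∀ {n} (i : Fin (suc n)) → rotation⁻¹ (rotation i) ≡ i
rotation⁻¹-rotation {n} zero = rotation⁻¹-last n
rotation⁻¹-rotation (suc i)  = rotation⁻¹-inject₁ i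

rotation-rotation⁻¹ : ∀ {n} (i : Fin (suc n)) → rotation (rotation⁻¹ i) ≡ i
rotation-rotation⁻¹ {zero}  zero    = refl
rotation-rotation⁻¹ {suc n} zero    = refl
rotation-rotation⁻¹ {suc n} (suc i) with rotation⁻¹ i | rotation-rotation⁻¹ i
... | zero  | refl = refl
... | suc j | refl = refl

rotate : ∀ {n} → Permutation (suc n) (suc n)
rotate = permutation rotation rotation⁻¹ rotation-rotation⁻¹ rotation⁻¹-rotation

module Form (p : ℕ) (prime : Prime p) {d : ℕ} (B : Vect d → Vect d → ℤ)
            (bilinear : IsBilinearForm p B) (skew : IsSkewSymmetric p B) where
  open Congruence p
  open PrimeField p prime using (solve-linear)
  open IsBilinearForm bilinear using (add-right; scale-right)
  open import Relation.Binary.Reasoning.Setoid ≋-setoid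

  infix 4 _⟂_ _⟂?_

  _⟂_ : Vect d → Vect d → Set
  x ⟂ y = B x y ≋ + 0

  _⟂?_ : ∀ x y → Dec (x ⟂ y)
  x ⟂? y = B x y ≋? + 0

  ⟂-sym : ∀ {x y} → x ⟂ y → y ⟂ x
  ⟂-sym {x} {y} x⟂y = begin
    B y x       ≈⟨ ≋-intro (skew y x) ⟩
    - B x y     ≈⟨ neg-cong x⟂y ⟩
    - + 0       ≡⟨⟩
    + 0         ∎

  B-transvect : ∀ x y z t → B x (y ⊕ (t ⊙ z)) ≋ B x y + t * B x z
  B-transvect x y z t = ≋-trans (≋-intro (add-right x y (t ⊙ z))) (+-congˡ (B x y) (≋-intro (scale-right t x z)))

  ⟂-transvect : ∀ {x y z} t → x ⟂ y → x ⟂ z → x ⟂ y ⊕ (t ⊙ z)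
  ⟂-transvect {x} {y} {z} t x⟂y x⟂z = begin
    B x (y ⊕ (t ⊙ z))   ≈⟨ B-transvect x y z t ⟩
    B x y + t * B x z   ≈⟨ +-cong x⟂y (*-congˡ t x⟂z) ⟩
    + 0 + t * + 0       ≡⟨ cong (_+_ (+ 0)) (ℤₚ.*-zeroʳ t) ⟩
    + 0                 ∎

  orthogonalise : ∀ x y z → ¬ x ⟂ z → Σ ℤ λ t → x ⟂ y ⊕ (t ⊙ z)
  orthogonalise x y z x⟂̸z =
    let t , solves = solve-linear (B x y) (B x z) x⟂̸z
    in  t , ≋-trans (B-transvect x y z t) solves

module Chains (p : ℕ) (prime : Prime p) {d : ℕ} (B : Vect d → Vect d → ℤ)
              (bilinear : IsBilinearForm p B) (skew : IsSkewSymmetric p B) where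
  open Bases p
  open Form p prime B bilinear skew

  Family : Set
  Family = Fin d → Vect d

  Chain : ℕ → Family → Set
  Chain n w = ∀ (i j : Fin d) → toℕ j ≡ suc (toℕ i) → toℕ j < n → w i ⟂ w j

  ChainBasis : ℕ → Set
  ChainBasis n = Σ Family λ w → IsBasis p w × Chain n w

  chain-mono : ∀ {m n w} → m ≤ n → Chain n w → Chain m w
  chain-mono m≤n chain i j j≡1+i j<m = chain i j j≡1+i (ℕₚ.<-≤-trans j<m m≤n)

  chain-local : ∀ {n} {w w′ : Family} → (∀ i → toℕ i < n → w′ i ≡ w i) → Chain n w → Chain n w′
  chain-local {n} same chain i j j≡1+i j<n = subst₂ _⟂_ (sym (same i i<n)) (sym (same j j<n)) (chain i j j≡1+i j<n)
    where
    i<n : toℕ i < n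
    i<n = ℕₚ.<-trans (ℕₚ.n<1+n (toℕ i)) (subst (_< n) j≡1+i j<n)

  below-≢ : ∀ {n} {i a : Fin d} → toℕ i < n → n ≤ toℕ a → i ≢ a
  below-≢ i<n n≤a refl = ℕₚ.<-irrefl refl (ℕₚ.<-≤-trans i<n n≤a)

  transvect-chain : ∀ {n w} (a b : Fin d) t → n ≤ toℕ a → Chain n w → Chain n (transvect a b t w)
  transvect-chain {w = w} a b t n≤a = chain-local λ i i<n → transvect-elsewhere b t w (below-≢ i<n n≤a)

  chain-extend : ∀ {m w} {c a : Fin d} → toℕ c ≡ m → toℕ a ≡ suc m → w c ⟂ w a →
                 Chain (suc m) w → Chain (suc (suc m)) w
  chain-extend {m} {w} {c} {a} c≡m a≡1+m c⟂a chain i j j≡1+i j<2+m with toℕ j ℕ.<? suc m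
  ... | yes j<1+m = chain i j j≡1+i j<1+m
  ... | no j≮1+m  = subst₂ (λ x y → w x ⟂ w y) (sym i≡c) (sym j≡a) c⟂a
    where
    j≡1+m : toℕ j ≡ suc m
    j≡1+m = ℕₚ.≤-antisym (ℕₚ.≤-pred j<2+m) (ℕₚ.≮⇒≥ j≮1+m)
    j≡a : j ≡ a
    j≡a = toℕ-injective (trans j≡1+m (sym a≡1+m))
    i≡c : i ≡ c
    i≡c = toℕ-injective (trans (ℕₚ.suc-injective (trans (sym j≡1+i) j≡1+m)) (sym c≡m))

  -- The inductive step, for the positions c = m, a = m+1 and b = m+2: if w_c ⟂ w_a
  -- there is nothing to do; if w_c ⟂ w_b, swap w_a and w_b; otherwise replace w_a
  -- by the vector w_a + t·w_b orthogonal to w_c.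
  module _ {m} {c a b : Fin d} (c≡m : toℕ c ≡ m) (a≡1+m : toℕ a ≡ suc m) (b≡2+m : toℕ b ≡ suc (suc m)) where

    private
      c<1+m : toℕ c < suc m
      c<1+m = ℕₚ.≤-reflexive (cong suc c≡m)
      a<2+m : toℕ a < suc (suc m)
      a<2+m = ℕₚ.≤-reflexive (cong suc a≡1+m)
      1+m≤a : suc m ≤ toℕ a
      1+m≤a = ℕₚ.≤-reflexive (sym a≡1+m)
      1+m≤b : suc m ≤ toℕ b
      1+m≤b = ℕₚ.≤-trans (ℕₚ.n≤1+n (suc m)) (ℕₚ.≤-reflexive (sym b≡2+m))
      2+m≤b : suc (suc m) ≤ toℕ b
      2+m≤b = ℕₚ.≤-reflexive (sym b≡2+m)

    extend-chain : ChainBasis (suc m) → ChainBasis (suc (suc m))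
    extend-chain (w , basis , chain) with w c ⟂? w a | w c ⟂? w b
    ... | yes c⟂a | _ = w , basis , chain-extend c≡m a≡1+m c⟂a chain
    ... | no _ | yes c⟂b =
      w ∘ (τ ⟨$⟩ʳ_) , permute-basis τ w basis ,
      chain-extend c≡m a≡1+m (subst₂ _⟂_ (sym (fixed c c<1+m)) (cong w (sym (transpose-here a b))) c⟂b)
                             (chain-local fixed chain)
      where
      τ : Permutation d d
      τ = transpose a b
      fixed : ∀ i → toℕ i < suc m → w (τ ⟨$⟩ʳ i) ≡ w i
      fixed i i<1+m = cong w (transpose-elsewhere a b i (below-≢ i<1+m 1+m≤a) (below-≢ i<1+m 1+m≤b))
    ... | no _ | no c⟂̸b =
      let t , c⟂a′ = orthogonalise (w c) (w a) (w b) c⟂̸b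
      in  transvect a b t w , transvect-basis w a b t (below-≢ a<2+m 2+m≤b) basis ,
          chain-extend c≡m a≡1+m (subst₂ _⟂_ (sym (transvect-elsewhere b t w (below-≢ c<1+m 1+m≤a)))
                                              (sym (transvect-here a b t w)) c⟂a′)
                                 (transvect-chain a b t 1+m≤a chain)

  build : ∀ m → suc m < d → ChainBasis (suc m)
  build zero _ = unit , standard-basis , λ i j j≡1+i j<1 → ⊥-elim (ℕₚ.n≮0 (ℕₚ.≤-pred (subst (_< 1) j≡1+i j<1)))
  build (suc m) 2+m<d = extend-chain (toℕ-fromℕ< m<d) (toℕ-fromℕ< 1+m<d) (toℕ-fromℕ< 2+m<d) (build m 1+m<d)
    where
    1+m<d : suc m < d
    1+m<d = ℕₚ.<-trans (ℕₚ.n<1+n (suc m)) 2+m<d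
    m<d : m < d
    m<d = ℕₚ.<-trans (ℕₚ.n<1+n m) 1+m<d

module Closing (p : ℕ) (prime : Prime p) (k : ℕ)
               (B : Vect (suc (suc (suc k))) → Vect (suc (suc (suc k))) → ℤ)
               (bilinear : IsBilinearForm p B) (skew : IsSkewSymmetric p B) where
  open Congruence p using (≋-elim)
  open Bases p
  open Form p prime B bilinear skew
  open Chains p prime B bilinear skew

  q<d : k < suc (suc (suc k))
  q<d = ℕₚ.m≤n+m (suc k) 2
  r<d : suc k < suc (suc (suc k))
  r<d = ℕₚ.m≤n+m (suc (suc k)) 1

  q r s : Fin (suc (suc (suc k)))
  q = fromℕ< q<d
  r = fromℕ< r<d
  s = fromℕ (suc (suc k))

  q≡k : toℕ q ≡ k
  q≡k = toℕ-fromℕ< q<d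
  r≡1+k : toℕ r ≡ suc k
  r≡1+k = toℕ-fromℕ< r<d
  s≡2+k : toℕ s ≡ suc (suc k)
  s≡2+k = toℕ-fromℕ (suc (suc k))

  q≢r : q ≢ r
  q≢r = below-≢ (ℕₚ.≤-reflexive (cong suc q≡k)) (ℕₚ.≤-reflexive (sym r≡1+k))
  r≢s : r ≢ s
  r≢s = below-≢ (ℕₚ.≤-reflexive (cong suc r≡1+k)) (ℕₚ.≤-reflexive (sym s≡2+k))
  s≢q : s ≢ q
  s≢q = below-≢ (ℕₚ.≤-reflexive (cong suc q≡k)) (ℕₚ.≤-trans (ℕₚ.n≤1+n (suc k)) (ℕₚ.≤-reflexive (sym s≡2+k))) ∘ sym
  r≢0 : r ≢ zero
  r≢0 r≡0 = ℕₚ.1+n≢0 (trans (sym r≡1+k) (cong toℕ r≡0))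
  0≢s : zero ≢ s
  0≢s 0≡s = ℕₚ.1+n≢0 (trans (sym s≡2+k) (cong toℕ (sym 0≡s)))

  Result : Set
  Result = Σ Family λ v → IsBasis p v ×
             (∀ (i j : Fin (suc (suc (suc k)))) → toℕ j ≡ suc (toℕ i) → B (v i) (v j) ≡[ p ] (+ 0))

  finish : ∀ w → IsBasis p w → Chain (suc (suc (suc k))) w → Result
  finish w basis chain = w , basis , λ i j j≡1+i → ≋-elim (chain i j j≡1+i (toℕ<n j))

  rotate-chain : ∀ w → IsBasis p w → Chain (suc (suc k)) w → w s ⟂ w zero → Result
  rotate-chain w basis chain s⟂0 = finish (w ∘ (rotate ⟨$⟩ʳ_)) (permute-basis rotate w basis) rotated
    where
    rotated : Chain (suc (suc (suc k))) (w ∘ (rotate ⟨$⟩ʳ_))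
    rotated zero    zero          ()
    rotated zero    (suc zero)    _ _ = s⟂0
    rotated zero    (suc (suc j)) ()
    rotated (suc i) zero          ()
    rotated (suc i) (suc j) j≡1+i j<d =
      chain (inject₁ i) (inject₁ j)
            (trans (toℕ-inject₁ j) (trans (ℕₚ.suc-injective j≡1+i) (cong suc (sym (toℕ-inject₁ i)))))
            (subst (_< suc (suc k)) (sym (toℕ-inject₁ j)) (ℕₚ.≤-pred j<d))

  -- w₀ ⟂̸ w_q: adding to w_s a multiple of w_q makes it orthogonal to w₀; then rotate
  close-via-q : ∀ w → IsBasis p w → Chain (suc (suc k)) w → ¬ w zero ⟂ w q → Result
  close-via-q w basis chain 0⟂̸q =
    rotate-chain w′ (transvect-basis w s q t s≢q basis)
                 (transvect-chain s q t (ℕₚ.≤-reflexive (sym s≡2+k)) chain) s⟂0′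
    where
    t : ℤ
    t = proj₁ (orthogonalise (w zero) (w s) (w q) 0⟂̸q)
    w′ : Family
    w′ = transvect s q t w
    s⟂0′ : w′ s ⟂ w′ zero
    s⟂0′ = ⟂-sym (subst₂ _⟂_ (sym (transvect-elsewhere q t w 0≢s)) (sym (transvect-here s q t w))
                          (proj₂ (orthogonalise (w zero) (w s) (w q) 0⟂̸q)))

  -- w₀ ⟂ w_q but w₀ ⟂̸ w_s: replace w_r by the vector w_r + t·w₀ orthogonal to w_s;
  -- the pair (q, r) survives because w_q ⟂ w₀
  close-via-0 : ∀ w → IsBasis p w → Chain (suc (suc k)) w → w zero ⟂ w q → ¬ w zero ⟂ w s → Result
  close-via-0 w basis chain 0⟂q 0⟂̸s =
    finish w′ (transvect-basis w r zero t r≢0 basis)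
              (chain-extend r≡1+k s≡2+k r⟂s′ (chain-extend q≡k r≡1+k q⟂r′ shorter))
    where
    t : ℤ
    t = proj₁ (orthogonalise (w s) (w r) (w zero) (0⟂̸s ∘ ⟂-sym))
    s⟂r′ : w s ⟂ w r ⊕ (t ⊙ w zero)
    s⟂r′ = proj₂ (orthogonalise (w s) (w r) (w zero) (0⟂̸s ∘ ⟂-sym))
    w′ : Family
    w′ = transvect r zero t w
    r-updated : w′ r ≡ w r ⊕ (t ⊙ w zero)
    r-updated = transvect-here r zero t w
    shorter : Chain (suc k) w′
    shorter = transvect-chain r zero t (ℕₚ.≤-reflexive (sym r≡1+k)) (chain-mono (ℕₚ.n≤1+n (suc k)) chain)
    q⟂r′ : w′ q ⟂ w′ r
    q⟂r′ = subst₂ _⟂_ (sym (transvect-elsewhere zero t w q≢r)) (sym r-updated)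
             (⟂-transvect t (chain q r (trans r≡1+k (cong suc (sym q≡k))) (ℕₚ.≤-reflexive (cong suc r≡1+k)))
                            (⟂-sym 0⟂q))
    r⟂s′ : w′ r ⟂ w′ s
    r⟂s′ = ⟂-sym (subst₂ _⟂_ (sym (transvect-elsewhere zero t w (r≢s ∘ sym))) (sym r-updated) s⟂r′)

  close : ChainBasis (suc (suc k)) → Result
  close (w , basis , chain) with w r ⟂? w s | w zero ⟂? w s | w zero ⟂? w q
  ... | yes r⟂s | _        | _      = finish w basis (chain-extend r≡1+k s≡2+k r⟂s chain)
  ... | no _    | yes 0⟂s  | _      = rotate-chain w basis chain (⟂-sym 0⟂s)
  ... | no _    | no _     | no 0⟂̸q = close-via-q w basis chain 0⟂̸q
  ... | no _    | no 0⟂̸s  | yes 0⟂q = close-via-0 w basis chain 0⟂q 0⟂̸s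

  theorem : Result
  theorem = close (build (suc k) (ℕₚ.n<1+n (suc (suc k))))

lemma4p9 : (p : ℕ) → Prime p → (d : ℕ) → 3 ≤ d →
    (B : Vect d → Vect d → ℤ) → IsBilinearForm p B → IsSkewSymmetric p B →
    Σ (Fin d → Vect d) λ v → IsBasis p v ×
      (∀ (i j : Fin d) → toℕ j ≡ suc (toℕ i) → B (v i) (v j) ≡[ p ] (+ 0))
lemma4p9 p p-prime (suc (suc (suc k))) (s≤s (s≤s (s≤s z≤n))) B bilinear skew =
  Closing.theorem p p-prime k B bilinear skew
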